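{- Let $E$ be an equational axiomatization over $\mathrm{BCCS}(A)$ that is sound for $\sqsubseteq_{\rm WIF}$ (every equation $t\approx u$ in $E$ satisfies $t\sqsubseteq_{\rm WIF}u$ and $u\sqsubseteq_{\rm WIF}t$), let $p,q$ be closed terms, $a\in A$, and $m$ an integer such that (1) $p\approx q$ is derivable from $E$ in equational logic; (2) $m>|u|$ for every equation $t\approx u$ in $E$; (3) $\mathcal{CT}(q)\subseteq\{a^m,a^{2m}\}$; (4) there is a closed term $p'$ with $p\Rightarrow\xrightarrow{\tau}p'$ and $\mathcal{CT}(p')=\{a^{2m}\}$. Then there is a closed term $q'$ with $q\Rightarrow\xrightarrow{\tau}q'$ and $\mathcal{CT}(q')=\{a^{2m}\}$.
   Context: $\mathrm{BCCS}(A)$: $A$ nonempty set of visible actions, $\tau\notin A$, countably infinite variable set $V$; terms $t::=\mathbf{0}\mid\alpha t\mid t+t\mid x$, $\alpha\in A\cup\{\tau\}$. Depth: $|\mathbf{0}|=|x|=0$, $|bt|=1+|t|$ for $b\in A$, $|\tau t|=|t|$, $|t+u|=\max(|t|,|u|)$. Transitions: $\alpha t\xrightarrow{\alpha}t$; if $t\xrightarrow{\alpha}t'$ then $t+u\xrightarrow{\alpha}t'$, $u+t\xrightarrow{\alpha}t'$. $\Rightarrow$: zero or more $\tau$-steps; $t\Rightarrow\xrightarrow{\tau}t'$ means $t\Rightarrow v\xrightarrow{\tau}t'$. $\mathcal{I}(p)=\{b\in A\mid p\Rightarrow\xrightarrow{b}\}$. Traces $\mathcal{T}(p)$: $a_1\cdots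 a_k\in A^*$ with $p\Rightarrow\xrightarrow{a_1}\Rightarrow\cdots\Rightarrow\xrightarrow{a_k}\Rightarrow p_k$; completed traces $\mathcal{CT}(p)$: those with moreover $\mathcal{I}(p_k)=\emptyset$. $(a_1\cdots a_k,B)$, $B\subseteq A^*$, is a weak impossible future of $p$ if such a path exists with $\mathcal{T}(p_k)\cap B=\emptyset$. $p\sqsubseteq_{\rm WIF}q$ iff (1) every weak impossible future of $p$ is one of $q$, (2) $\mathcal{T}(p)=\mathcal{T}(q)$, (3) $p\xrightarrow{\tau}$ implies $q\xrightarrow{\tau}$; on open terms via all closed substitutions. Equational logic: reflexivity, symmetry, transitivity, substitution, closure under BCCS operators. $a^n$ is $n$ copies of $a$. -}

module Defs where

open import Data.Nat using (ℕ; suc; _⊔_; _<_; _*_)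
open import Data.List using (List; []; _∷_; replicate)
open import Data.Product using (Σ; ∃; _×_; _,_)
open import Data.Empty using (⊥)
open import Relation.Nullary using (¬_)

-- Parametrised by the set A of visible actions; τ is a separate constructor,
-- so τ ∉ A by construction.  Variables V = ℕ (countably infinite).
module BCCS (A : Set) where

  data Act : Set where
    τ   : Act
    vis : A → Act

  data Term : Set where
    𝟎    : Term
    _·_  : Act → Term → Term
    _⊕_  : Term → Term → Term
    var  : ℕ → Term

  infixr 6 _·_
  infixl 5 _⊕_

  data Closed : Term → Set where
    c𝟎 : Closed 𝟎
    c· : ∀ {α t} → Closed t → Closed (α · t)
    c⊕ : ∀ {t u} → Closed t → Closed u → Closed (t ⊕ u)

  Subst : Set
  Subst = ℕ → Term

  ClosedSubst : Subst → Set
  ClosedSubst σ = ∀ x → Closed (σ x)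

  _[_] : Term → Subst → Term
  𝟎 [ σ ] = 𝟎
  (α · t) [ σ ] = α · (t [ σ ])
  (t ⊕ u) [ σ ] = (t [ σ ]) ⊕ (u [ σ ])
  var x [ σ ] = σ x

  depth : Term → ℕ
  depth 𝟎 = 0
  depth (var x) = 0
  depth (τ · t) = depth t
  depth (vis b · t) = suc (depth t)
  depth (t ⊕ u) = depth t ⊔ depth u

  data _—[_]→_ : Term → Act → Term → Set where
    pref : ∀ {α t} → (α · t) —[ α ]→ t
    sumL : ∀ {t u α t'} → t —[ α ]→ t' → (t ⊕ u) —[ α ]→ t'
    sumR : ∀ {t u α t'} → t —[ α ]→ t' → (u ⊕ t) —[ α ]→ t'

  data _=[_]⇒_ : Term → List A → Term → Set where
    wrefl : ∀ {p} → p =[ [] ]⇒ p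
    wtau  : ∀ {p p' s r} → p —[ τ ]→ p' → p' =[ s ]⇒ r → p =[ s ]⇒ r
    wvis  : ∀ {p p' b s r} → p —[ vis b ]→ p' → p' =[ s ]⇒ r → p =[ b ∷ s ]⇒ r

  _⇒_ : Term → Term → Set
  p ⇒ r = p =[ [] ]⇒ r

  _⇒τ_ : Term → Term → Set
  p ⇒τ p' = ∃ λ v → (p ⇒ v) × (v —[ τ ]→ p')

  Init : Term → A → Set
  Init p b = ∃ λ v → ∃ λ v' → (p ⇒ v) × (v —[ vis b ]→ v')

  Traces : Term → List A → Set
  Traces p s = ∃ λ pk → p =[ s ]⇒ pk

  CTraces : Term → List A → Set
  CTraces p s = ∃ λ pk → (p =[ s ]⇒ pk) × (∀ b → ¬ Init pk b)

  WIF : Term → List A → (List A → Set) → Set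
  WIF p s B = ∃ λ pk → (p =[ s ]⇒ pk) × (∀ w → Traces pk w → ¬ B w)

  _⊑WIF_ : Term → Term → Set₁
  p ⊑WIF q =
      (∀ s (B : List A → Set) → WIF p s B → WIF q s B)
    × (∀ s → (Traces p s → Traces q s) × (Traces q s → Traces p s))
    × (∀ p' → p —[ τ ]→ p' → ∃ λ q' → q —[ τ ]→ q')

  _⊑WIFo_ : Term → Term → Set₁
  t ⊑WIFo u = ∀ σ → ClosedSubst σ → (t [ σ ]) ⊑WIF (u [ σ ])

  Axioms : Set₁
  Axioms = Term → Term → Set

  Sound : Axioms → Set₁
  Sound E = ∀ t u → E t u → (t ⊑WIFo u) × (u ⊑WIFo t)

  data _⊢_≈_ (E : Axioms) : Term → Term → Set where
    ax    : ∀ {t u} → E t u → E ⊢ t ≈ u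
    refl≈ : ∀ {t} → E ⊢ t ≈ t
    sym≈  : ∀ {t u} → E ⊢ t ≈ u → E ⊢ u ≈ t
    trans≈ : ∀ {t u v} → E ⊢ t ≈ u → E ⊢ u ≈ v → E ⊢ t ≈ v
    subst≈ : ∀ {t u} (σ : Subst) → E ⊢ t ≈ u → E ⊢ (t [ σ ]) ≈ (u [ σ ])
    pref≈ : ∀ {t u} (α : Act) → E ⊢ t ≈ u → E ⊢ (α · t) ≈ (α · u)
    sum≈  : ∀ {t t' u u'} → E ⊢ t ≈ t' → E ⊢ u ≈ u' → E ⊢ (t ⊕ u) ≈ (t' ⊕ u')

  pow : A → ℕ → List A
  pow a n = replicate n a

module Submission where

open import Defs
open import Data.Nat using (ℕ; zero; suc; _<_; _*_; _+_; _≤_; s≤s; _≟_)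
open import Data.Nat.Properties
open import Data.List using (List; []; _∷_; _++_; length)
open import Data.List.Properties using (length-++; length-++-≤ʳ; length-replicate)
open import Data.List.Membership.Propositional using (_∈_)
open import Data.List.Membership.Propositional.Properties using (∈-++⁺ˡ; ∈-++⁺ʳ; ∈-++⁻)
open import Data.List.Membership.DecPropositional _≟_ using (_∈?_)
open import Data.List.Relation.Unary.Any using (here)
open import Data.Product using (Σ; ∃; _×_; _,_; proj₁; proj₂; swap)
open import Data.Sum using (_⊎_; inj₁; inj₂; [_,_]′)
open import Data.Empty using (⊥-elim)
open import Function using (_∘_)
open import Relation.Nullary using (¬_; yes; no)
open import Relation.Binary.PropositionalEquality
  using (_≡_; refl; sym; trans; cong; cong₂; subst; subst₂; module ≡-Reasoning)

-- Induction on derivations shows, for all closed instances t[σ], u[σ] of a derivable t ≈ u: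
-- if t[σ] has a τ-derivative whose only completed trace is a^2m and every completed trace of
-- u[σ] is a^m or a^2m, then u[σ] has such a τ-derivative too.  Only the axiom case is
-- substantial.  If the τ-step of t[σ] happens inside σ x, for a variable x that t reaches by
-- τ-steps, instantiating x by a^(|u|+1) shows that u reaches x by τ-steps as well.  If it is a
-- τ-step t₂ → t' of t itself, instantiating the variables outside t' by a^(2m+1) and applying
-- soundness to the impossible future (ε, complement of T(t'[σ])) gives a τ-derivative u' of u
-- all of whose variables occur in t'.  A completed trace a^m of u'[σ] can neither stay inside
-- u', as |u| < m, nor enter a variable of t', because every run from there completes a^2m
-- after a prefix of length ≤ |t'| < m.

module WeakPaths (A : Set) where
  open BCCS A

  _∷ᵛ_ : Act → List A → List A
  τ ∷ᵛ s = s
  vis b ∷ᵛ s = b ∷ s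

  step-⇒ : ∀ {p p' α s r} → p —[ α ]→ p' → p' =[ s ]⇒ r → p =[ α ∷ᵛ s ]⇒ r
  step-⇒ {α = τ} st π = wtau st π
  step-⇒ {α = vis b} st π = wvis st π

  infixr 5 _++ᵖ_
  _++ᵖ_ : ∀ {p q r s s'} → p =[ s ]⇒ q → q =[ s' ]⇒ r → p =[ s ++ s' ]⇒ r
  wrefl ++ᵖ π = π
  wtau st ρ ++ᵖ π = wtau st (ρ ++ᵖ π)
  wvis st ρ ++ᵖ π = wvis st (ρ ++ᵖ π)

  path-⊕ˡ : ∀ {p q s r} → p =[ s ]⇒ r → ((p ⊕ q) =[ s ]⇒ r) ⊎ ((r ≡ p) × (s ≡ []))
  path-⊕ˡ wrefl = inj₂ (refl , refl)
  path-⊕ˡ (wtau st π) = inj₁ (wtau (sumL st) π)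
  path-⊕ˡ (wvis st π) = inj₁ (wvis (sumL st) π)

  path-⊕ʳ : ∀ {p q s r} → p =[ s ]⇒ r → ((q ⊕ p) =[ s ]⇒ r) ⊎ ((r ≡ p) × (s ≡ []))
  path-⊕ʳ wrefl = inj₂ (refl , refl)
  path-⊕ʳ (wtau st π) = inj₁ (wtau (sumR st) π)
  path-⊕ʳ (wvis st π) = inj₁ (wvis (sumR st) π)

  τ-Enabled : Term → Set
  τ-Enabled p = ∃ λ r → p —[ τ ]→ r

  τ-step-⇒τ : ∀ {p p₁ p₂} → p —[ τ ]→ p₁ → p₁ ⇒ p₂ → p ⇒τ p₂
  τ-step-⇒τ st wrefl = _ , wrefl , st
  τ-step-⇒τ st (wtau st' π) with τ-step-⇒τ st' π
  ... | v , π' , st'' = v , wtau st π' , st''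

  ⇒-⇒τ : ∀ {p q r} → p ⇒ q → q ⇒τ r → p ⇒τ r
  ⇒-⇒τ π₀ (v , π , st) = v , π₀ ++ᵖ π , st

  ⇒τ⇒⇒ : ∀ {p r} → p ⇒τ r → p ⇒ r
  ⇒τ⇒⇒ (v , π , st) = π ++ᵖ wtau st wrefl

  ⇒τ⇒τ-Enabled : ∀ {p r} → p ⇒τ r → τ-Enabled p
  ⇒τ⇒τ-Enabled (_ , wrefl , st) = _ , st
  ⇒τ⇒τ-Enabled (_ , wtau st _ , _) = _ , st

  ⇒τ-⊕ˡ : ∀ {p q r} → p ⇒τ r → (p ⊕ q) ⇒τ r
  ⇒τ-⊕ˡ (v , wrefl , st) = _ , wrefl , sumL st
  ⇒τ-⊕ˡ (v , wtau st₀ π , st) = v , wtau (sumL st₀) π , st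

  ⇒τ-⊕ʳ : ∀ {p q r} → p ⇒τ r → (q ⊕ p) ⇒τ r
  ⇒τ-⊕ʳ (v , wrefl , st) = _ , wrefl , sumR st
  ⇒τ-⊕ʳ (v , wtau st₀ π , st) = v , wtau (sumR st₀) π , st

  Dead : Term → Set
  Dead p = ∀ b → ¬ Init p b

  𝟎-dead : Dead 𝟎
  𝟎-dead b (_ , _ , wrefl , ())
  𝟎-dead b (_ , _ , wtau () _ , _)

  var-dead : ∀ {x} → Dead (var x)
  var-dead b (_ , _ , wrefl , ())
  var-dead b (_ , _ , wtau () _ , _)

  Init-⊕⁻ : ∀ {p q b} → Init (p ⊕ q) b → Init p b ⊎ Init q b
  Init-⊕⁻ (v , v' , wrefl , sumL st) = inj₁ (_ , v' , wrefl , st)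
  Init-⊕⁻ (v , v' , wrefl , sumR st) = inj₂ (_ , v' , wrefl , st)
  Init-⊕⁻ (v , v' , wtau (sumL st) π , st') = inj₁ (v , v' , wtau st π , st')
  Init-⊕⁻ (v , v' , wtau (sumR st) π , st') = inj₂ (v , v' , wtau st π , st')

  Init-⊕ˡ : ∀ {p q b} → Init p b → Init (p ⊕ q) b
  Init-⊕ˡ {q = q} (v , v' , π , st) with path-⊕ˡ {q = q} π
  ... | inj₁ π' = v , v' , π' , st
  ... | inj₂ (refl , refl) = _ , v' , wrefl , sumL st

  Init-⊕ʳ : ∀ {p q b} → Init p b → Init (q ⊕ p) b
  Init-⊕ʳ {q = q} (v , v' , π , st) with path-⊕ʳ {q = q} π
  ... | inj₁ π' = v , v' , π' , st
  ... | inj₂ (refl , refl) = _ , v' , wrefl , sumR st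

  Init-⇒ : ∀ {p r b} → p ⇒ r → Init r b → Init p b
  Init-⇒ π (v , v' , π' , st) = v , v' , π ++ᵖ π' , st

  Init⇒Traces : ∀ {p b} → Init p b → Traces p (b ∷ [])
  Init⇒Traces (v , v' , π , st) = v' , π ++ᵖ wvis st wrefl

  Traces⇒Init : ∀ {p b} → Traces p (b ∷ []) → Init p b
  Traces⇒Init (r , wtau st π) = Init-⇒ (wtau st wrefl) (Traces⇒Init (r , π))
  Traces⇒Init (r , wvis st π) = _ , _ , wrefl , st

  Traces-⊕ˡ : ∀ {p q s} → Traces p s → Traces (p ⊕ q) s
  Traces-⊕ˡ {q = q} (r , π) with path-⊕ˡ {q = q} π
  ... | inj₁ π' = r , π'
  ... | inj₂ (refl , refl) = _ , wrefl

  Traces-⊕ʳ : ∀ {p q s} → Traces p s → Traces (q ⊕ p) s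
  Traces-⊕ʳ {q = q} (r , π) with path-⊕ʳ {q = q} π
  ... | inj₁ π' = r , π'
  ... | inj₂ (refl , refl) = _ , wrefl

  CTraces-⇒ : ∀ {p r s} → p ⇒ r → CTraces r s → CTraces p s
  CTraces-⇒ π (d , π' , dd) = d , π ++ᵖ π' , dd

  -- A τ-enabled summand keeps its completed traces, even the empty one.
  CTraces-⊕ˡ : ∀ {p q s} → τ-Enabled p → CTraces p s → CTraces (p ⊕ q) s
  CTraces-⊕ˡ {q = q} (r , st) (d , π , dd) with path-⊕ˡ {q = q} π
  ... | inj₁ π' = d , π' , dd
  ... | inj₂ (refl , refl) = r , wtau (sumL st) wrefl , λ c i → dd c (Init-⇒ (wtau st wrefl) i)

  CTraces-⊕ʳ : ∀ {p q s} → τ-Enabled p → CTraces p s → CTraces (q ⊕ p) s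
  CTraces-⊕ʳ {q = q} (r , st) (d , π , dd) with path-⊕ʳ {q = q} π
  ... | inj₁ π' = d , π' , dd
  ... | inj₂ (refl , refl) = r , wtau (sumR st) wrefl , λ c i → dd c (Init-⇒ (wtau st wrefl) i)

  CTraces-∷-⊕ˡ : ∀ {p q b s} → CTraces p (b ∷ s) → CTraces (p ⊕ q) (b ∷ s)
  CTraces-∷-⊕ˡ {q = q} (d , π , dd) with path-⊕ˡ {q = q} π
  ... | inj₁ π' = d , π' , dd
  ... | inj₂ (_ , ())

  CTraces-∷-⊕ʳ : ∀ {p q b s} → CTraces p (b ∷ s) → CTraces (q ⊕ p) (b ∷ s)
  CTraces-∷-⊕ʳ {q = q} (d , π , dd) with path-⊕ʳ {q = q} π
  ... | inj₁ π' = d , π' , dd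
  ... | inj₂ (_ , ())

  ctrace-exists : ∀ p → ∃ (CTraces p)
  ctrace-exists 𝟎 = [] , 𝟎 , wrefl , 𝟎-dead
  ctrace-exists (var x) = [] , var x , wrefl , var-dead
  ctrace-exists (α · p) with ctrace-exists p
  ... | s , d , π , dd = α ∷ᵛ s , d , step-⇒ pref π , dd
  ctrace-exists (p ⊕ q) with ctrace-exists p | ctrace-exists q
  ... | s , d , π , dd | s' , d' , π' , dd' with path-⊕ˡ {q = q} π | path-⊕ʳ {q = p} π'
  ... | inj₁ π₁ | _ = s , d , π₁ , dd
  ... | inj₂ _ | inj₁ π₂ = s' , d' , π₂ , dd'
  ... | inj₂ (refl , refl) | inj₂ (refl , refl) =
    [] , p ⊕ q , wrefl , λ b i → [ dd b , dd' b ]′ (Init-⊕⁻ i)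

module Substitution (A : Set) where
  open BCCS A
  open WeakPaths A

  data TopVar : Term → ℕ → Set where
    here  : ∀ {x} → TopVar (var x) x
    left  : ∀ {t u x} → TopVar t x → TopVar (t ⊕ u) x
    right : ∀ {t u x} → TopVar u x → TopVar (t ⊕ u) x

  step-[]⁻ : ∀ {α r} σ t → (t [ σ ]) —[ α ]→ r →
    (∃ λ t' → (t —[ α ]→ t') × (r ≡ t' [ σ ])) ⊎ (∃ λ x → TopVar t x × (σ x —[ α ]→ r))
  step-[]⁻ σ 𝟎 ()
  step-[]⁻ σ (α · t) pref = inj₁ (t , pref , refl)
  step-[]⁻ σ (t ⊕ u) (sumL st) with step-[]⁻ σ t st
  ... | inj₁ (t' , st' , eq) = inj₁ (t' , sumL st' , eq)
  ... | inj₂ (x , tv , st') = inj₂ (x , left tv , st')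
  step-[]⁻ σ (t ⊕ u) (sumR st) with step-[]⁻ σ u st
  ... | inj₁ (t' , st' , eq) = inj₁ (t' , sumR st' , eq)
  ... | inj₂ (x , tv , st') = inj₂ (x , right tv , st')
  step-[]⁻ σ (var x) st = inj₂ (x , here , st)

  step-[]⁺ : ∀ σ {t α t'} → t —[ α ]→ t' → (t [ σ ]) —[ α ]→ (t' [ σ ])
  step-[]⁺ σ pref = pref
  step-[]⁺ σ (sumL st) = sumL (step-[]⁺ σ st)
  step-[]⁺ σ (sumR st) = sumR (step-[]⁺ σ st)

  path-[]⁺ : ∀ σ {t s t'} → t =[ s ]⇒ t' → (t [ σ ]) =[ s ]⇒ (t' [ σ ])
  path-[]⁺ σ wrefl = wrefl
  path-[]⁺ σ (wtau st π) = wtau (step-[]⁺ σ st) (path-[]⁺ σ π)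
  path-[]⁺ σ (wvis st π) = wvis (step-[]⁺ σ st) (path-[]⁺ σ π)

  TopVar-step : ∀ σ {t x α r} → TopVar t x → σ x —[ α ]→ r → (t [ σ ]) —[ α ]→ r
  TopVar-step σ here st = st
  TopVar-step σ (left tv) st = sumL (TopVar-step σ tv st)
  TopVar-step σ (right tv) st = sumR (TopVar-step σ tv st)

  TopVar-⇒τ : ∀ σ {t x r} → TopVar t x → σ x ⇒τ r → (t [ σ ]) ⇒τ r
  TopVar-⇒τ σ tv (v , wrefl , st) = _ , wrefl , TopVar-step σ tv st
  TopVar-⇒τ σ tv (v , wtau st₀ π , st) = v , wtau (TopVar-step σ tv st₀) π , st

  data Split (σ : Subst) (t : Term) (s : List A) (r : Term) : Set where
    inside  : ∀ {t'} → t =[ s ]⇒ t' → r ≡ t' [ σ ] → Split σ t s r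
    through : ∀ {s₁ t₁ x α r₀ s₂} → t =[ s₁ ]⇒ t₁ → TopVar t₁ x → σ x —[ α ]→ r₀ →
              r₀ =[ s₂ ]⇒ r → s ≡ s₁ ++ (α ∷ᵛ s₂) → Split σ t s r

  split : ∀ σ t {s r} → (t [ σ ]) =[ s ]⇒ r → Split σ t s r
  split σ t wrefl = inside wrefl refl
  split σ t (wtau st π) with step-[]⁻ σ t st
  ... | inj₂ (x , tv , st') = through wrefl tv st' π refl
  ... | inj₁ (t' , st' , refl) with split σ t' π
  ...   | inside π' eq = inside (wtau st' π') eq
  ...   | through π' tv st'' π'' eq = through (wtau st' π') tv st'' π'' eq
  split σ t (wvis st π) with step-[]⁻ σ t st
  ... | inj₂ (x , tv , st') = through wrefl tv st' π refl
  ... | inj₁ (t' , st' , refl) with split σ t' π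
  ...   | inside π' eq = inside (wvis st' π') eq
  ...   | through π' tv st'' π'' eq = through (wvis st' π') tv st'' π'' (cong (_ ∷_) eq)

  τ-step-depth : ∀ {t t'} → t —[ τ ]→ t' → depth t' ≤ depth t
  τ-step-depth pref = ≤-refl
  τ-step-depth (sumL {t} {u} st) = ≤-trans (τ-step-depth st) (m≤m⊔n (depth t) (depth u))
  τ-step-depth (sumR {t} {u} st) = ≤-trans (τ-step-depth st) (m≤n⊔m (depth u) (depth t))

  vis-step-depth : ∀ {t t' b} → t —[ vis b ]→ t' → depth t' < depth t
  vis-step-depth pref = ≤-refl
  vis-step-depth (sumL {t} {u} st) = ≤-trans (vis-step-depth st) (m≤m⊔n (depth t) (depth u))
  vis-step-depth (sumR {t} {u} st) = ≤-trans (vis-step-depth st) (m≤n⊔m (depth u) (depth t))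

  path-depth : ∀ {t s t'} → t =[ s ]⇒ t' → length s + depth t' ≤ depth t
  path-depth wrefl = ≤-refl
  path-depth (wtau st π) = ≤-trans (path-depth π) (τ-step-depth st)
  path-depth (wvis st π) = ≤-trans (s≤s (path-depth π)) (vis-step-depth st)

  path-length≤depth : ∀ {t s t'} → t =[ s ]⇒ t' → length s ≤ depth t
  path-length≤depth {s = s} {t'} π = ≤-trans (m≤m+n (length s) (depth t')) (path-depth π)

  path-depth-mono : ∀ {t s t'} → t =[ s ]⇒ t' → depth t' ≤ depth t
  path-depth-mono {s = s} {t'} π = ≤-trans (m≤n+m (depth t') (length s)) (path-depth π)

  vars : Term → List ℕ
  vars 𝟎 = []
  vars (α · t) = vars t
  vars (t ⊕ u) = vars t ++ vars u
  vars (var x) = x ∷ []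

  step-vars : ∀ {t α t' y} → t —[ α ]→ t' → y ∈ vars t' → y ∈ vars t
  step-vars pref i = i
  step-vars (sumL st) i = ∈-++⁺ˡ (step-vars st i)
  step-vars (sumR {t} {u} st) i = ∈-++⁺ʳ (vars u) (step-vars st i)

  path-vars : ∀ {t s t' y} → t =[ s ]⇒ t' → y ∈ vars t' → y ∈ vars t
  path-vars wrefl i = i
  path-vars (wtau st π) i = step-vars st (path-vars π i)
  path-vars (wvis st π) i = step-vars st (path-vars π i)

  TopVar⇒∈vars : ∀ {t y} → TopVar t y → y ∈ vars t
  TopVar⇒∈vars here = here refl
  TopVar⇒∈vars (left tv) = ∈-++⁺ˡ (TopVar⇒∈vars tv)
  TopVar⇒∈vars (right {t} tv) = ∈-++⁺ʳ (vars t) (TopVar⇒∈vars tv)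

  ∈vars⇒reachable : ∀ t {y} → y ∈ vars t → ∃ λ s → ∃ λ t' → (t =[ s ]⇒ t') × TopVar t' y
  ∈vars⇒reachable 𝟎 ()
  ∈vars⇒reachable (var x) (here refl) = [] , var x , wrefl , here
  ∈vars⇒reachable (α · t) i with ∈vars⇒reachable t i
  ... | s , t' , π , tv = α ∷ᵛ s , t' , step-⇒ pref π , tv
  ∈vars⇒reachable (t ⊕ u) i with ∈-++⁻ (vars t) i
  ... | inj₁ i' with ∈vars⇒reachable t i'
  ...   | s , t' , π , tv with path-⊕ˡ {q = u} π
  ...     | inj₁ π' = s , t' , π' , tv
  ...     | inj₂ (refl , refl) = [] , t ⊕ u , wrefl , left tv
  ∈vars⇒reachable (t ⊕ u) i | inj₂ i' with ∈vars⇒reachable u i'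
  ...   | s , t' , π , tv with path-⊕ʳ {q = t} π
  ...     | inj₁ π' = s , t' , π' , tv
  ...     | inj₂ (refl , refl) = [] , t ⊕ u , wrefl , right tv

  []-cong-vars : ∀ {ρ σ} t → (∀ y → y ∈ vars t → ρ y ≡ σ y) → t [ ρ ] ≡ t [ σ ]
  []-cong-vars 𝟎 f = refl
  []-cong-vars (α · t) f = cong (α ·_) ([]-cong-vars t f)
  []-cong-vars (t ⊕ u) f =
    cong₂ _⊕_ ([]-cong-vars t (λ y i → f y (∈-++⁺ˡ i))) ([]-cong-vars u (λ y i → f y (∈-++⁺ʳ (vars t) i)))
  []-cong-vars (var x) f = f x (here refl)

  _∘ˢ_ : Subst → Subst → Subst
  (σ ∘ˢ ρ) x = ρ x [ σ ]

  []-∘ : ∀ {ρ σ} t → (t [ ρ ]) [ σ ] ≡ t [ σ ∘ˢ ρ ]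
  []-∘ 𝟎 = refl
  []-∘ (α · t) = cong (α ·_) ([]-∘ t)
  []-∘ (t ⊕ u) = cong₂ _⊕_ ([]-∘ t) ([]-∘ u)
  []-∘ (var x) = refl

  closed-[] : ∀ {σ} → ClosedSubst σ → ∀ t → Closed (t [ σ ])
  closed-[] c 𝟎 = c𝟎
  closed-[] c (α · t) = c· (closed-[] c t)
  closed-[] c (t ⊕ u) = c⊕ (closed-[] c t) (closed-[] c u)
  closed-[] c (var x) = c x

  closed-∘ˢ : ∀ {σ} → ClosedSubst σ → ∀ ρ → ClosedSubst (σ ∘ˢ ρ)
  closed-∘ˢ c ρ x = closed-[] c (ρ x)

  closed-[]-id : ∀ {σ t} → Closed t → t [ σ ] ≡ t
  closed-[]-id c𝟎 = refl
  closed-[]-id (c· c) = cong (_ ·_) (closed-[]-id c)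
  closed-[]-id (c⊕ c d) = cong₂ _⊕_ (closed-[]-id c) (closed-[]-id d)

  closed-step : ∀ {p α p'} → Closed p → p —[ α ]→ p' → Closed p'
  closed-step (c· c) pref = c
  closed-step (c⊕ c d) (sumL st) = closed-step c st
  closed-step (c⊕ c d) (sumR st) = closed-step d st

  closed-path : ∀ {p s p'} → Closed p → p =[ s ]⇒ p' → Closed p'
  closed-path c wrefl = c
  closed-path c (wtau st π) = closed-path (closed-step c st) π
  closed-path c (wvis st π) = closed-path (closed-step c st) π

  module Patch (V : List ℕ) (σ : Subst) (d : Term) where

    patch : Subst
    patch y with y ∈? V
    ... | yes _ = σ y
    ... | no _ = d

    patch-∈ : ∀ {y} → y ∈ V → patch y ≡ σ y
    patch-∈ {y} y∈V with y ∈? V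
    ... | yes _ = refl
    ... | no y∉V = ⊥-elim (y∉V y∈V)

    patch-∉ : ∀ {y} → ¬ y ∈ V → patch y ≡ d
    patch-∉ {y} y∉V with y ∈? V
    ... | yes y∈V = ⊥-elim (y∉V y∈V)
    ... | no _ = refl

    patch-step : ∀ {y α r} → patch y —[ α ]→ r → (y ∈ V × σ y —[ α ]→ r) ⊎ (¬ y ∈ V × d —[ α ]→ r)
    patch-step {y} st with y ∈? V
    ... | yes y∈V = inj₁ (y∈V , st)
    ... | no y∉V = inj₂ (y∉V , st)

    patch-closed : ClosedSubst σ → Closed d → ClosedSubst patch
    patch-closed cσ cd y with y ∈? V
    ... | yes _ = cσ y
    ... | no _ = cd

module Preorder (A : Set) where
  open BCCS A
  open WeakPaths A
  open Substitution A

  record _≼_ (p q : Term) : Set where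
    field
      τ-enabled : τ-Enabled p → τ-Enabled q
      ctraces   : ∀ {s} → CTraces p s → CTraces q s
      inits     : ∀ {b} → Init p b → Init q b
  open _≼_ public

  _≍_ : Term → Term → Set
  p ≍ q = p ≼ q × q ≼ p

  -- s is a completed trace iff (s , one-letter words) is a weak impossible future.
  ⊑WIF⇒≼ : ∀ {p q} → p ⊑WIF q → p ≼ q
  ⊑WIF⇒≼ {p} {q} (wif , traces , τ-sim) = record
    { τ-enabled = λ (r , st) → τ-sim r st
    ; ctraces   = ctraces′
    ; inits     = λ {b} i → Traces⇒Init (proj₁ (traces (b ∷ [])) (Init⇒Traces i))
    }
    where
    Singleton : List A → Set
    Singleton w = ∃ λ b → w ≡ b ∷ []
    ctraces′ : ∀ {s} → CTraces p s → CTraces q s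
    ctraces′ {s} (d , π , dd) with wif s Singleton (d , π , λ { w tr (b , refl) → dd b (Traces⇒Init tr) })
    ... | q' , π' , h = q' , π' , λ b i → h (b ∷ []) (Init⇒Traces i) (b , refl)

  ≼-refl : ∀ {p} → p ≼ p
  ≼-refl = record { τ-enabled = λ x → x ; ctraces = λ c → c ; inits = λ i → i }

  ≼-trans : ∀ {p q r} → p ≼ q → q ≼ r → p ≼ r
  ≼-trans R S = record
    { τ-enabled = λ x → τ-enabled S (τ-enabled R x)
    ; ctraces   = λ c → ctraces S (ctraces R c)
    ; inits     = λ i → inits S (inits R i)
    }

  Init-τ·⁺ : ∀ {p b} → Init p b → Init (τ · p) b
  Init-τ·⁺ = Init-⇒ (wtau pref wrefl)

  Init-τ·⁻ : ∀ {p b} → Init (τ · p) b → Init p b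
  Init-τ·⁻ (_ , _ , wrefl , ())
  Init-τ·⁻ (v , v' , wtau pref π , st) = v , v' , π , st

  CTraces-τ·⁺ : ∀ {p s} → CTraces p s → CTraces (τ · p) s
  CTraces-τ·⁺ = CTraces-⇒ (wtau pref wrefl)

  CTraces-τ·⁻ : ∀ {p s} → CTraces (τ · p) s → CTraces p s
  CTraces-τ·⁻ (d , wrefl , dd) = _ , wrefl , λ b i → dd b (Init-τ·⁺ i)
  CTraces-τ·⁻ (d , wtau pref π , dd) = d , π , dd

  ≼-τ· : ∀ {p q} → p ≼ q → (τ · p) ≼ (τ · q)
  ≼-τ· {q = q} R = record
    { τ-enabled = λ _ → q , pref
    ; ctraces   = λ c → CTraces-τ·⁺ (ctraces R (CTraces-τ·⁻ c))
    ; inits     = λ i → Init-τ·⁺ (inits R (Init-τ·⁻ i))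
    }

  ≼-vis· : ∀ {p q b} → p ≼ q → (vis b · p) ≼ (vis b · q)
  ≼-vis· {p} {q} {b} R = record
    { τ-enabled = λ { (_ , ()) }
    ; ctraces   = ctraces′
    ; inits     = λ { (_ , _ , wrefl , pref) → _ , _ , wrefl , pref }
    }
    where
    ctraces′ : ∀ {s} → CTraces (vis b · p) s → CTraces (vis b · q) s
    ctraces′ (d , wrefl , dd) = ⊥-elim (dd b (_ , _ , wrefl , pref))
    ctraces′ (d , wvis pref π , dd) with ctraces R (d , π , dd)
    ... | d' , π' , dd' = d' , wvis pref π' , dd'

  Init-⊕-mono : ∀ {p q p' q'} → p ≼ q → p' ≼ q' → ∀ {b} → Init (p ⊕ p') b → Init (q ⊕ q') b
  Init-⊕-mono R R' i = [ (λ j → Init-⊕ˡ (inits R j)) , (λ j → Init-⊕ʳ (inits R' j)) ]′ (Init-⊕⁻ i)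

  -- The empty completed trace of p ⊕ p' needs the converse initials inclusions.
  ≼-⊕ : ∀ {p q p' q'} → p ≍ q → p' ≍ q' → (p ⊕ p') ≼ (q ⊕ q')
  ≼-⊕ {p} {q} {p'} {q'} (R , Rᵒ) (R' , R'ᵒ) = record
    { τ-enabled = τ-enabled′
    ; ctraces   = ctraces′
    ; inits     = Init-⊕-mono R R'
    }
    where
    τ-enabled′ : τ-Enabled (p ⊕ p') → τ-Enabled (q ⊕ q')
    τ-enabled′ (r , sumL st) = _ , sumL (proj₂ (τ-enabled R (r , st)))
    τ-enabled′ (r , sumR st) = _ , sumR (proj₂ (τ-enabled R' (r , st)))
    ctraces′ : ∀ {s} → CTraces (p ⊕ p') s → CTraces (q ⊕ q') s
    ctraces′ (d , wrefl , dd) = _ , wrefl , λ b i → dd b (Init-⊕-mono Rᵒ R'ᵒ i)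
    ctraces′ (d , wtau (sumL st) π , dd) = CTraces-⊕ˡ (τ-enabled R (_ , st)) (ctraces R (d , wtau st π , dd))
    ctraces′ (d , wtau (sumR st) π , dd) = CTraces-⊕ʳ (τ-enabled R' (_ , st)) (ctraces R' (d , wtau st π , dd))
    ctraces′ (d , wvis (sumL st) π , dd) = CTraces-∷-⊕ˡ (ctraces R (d , wvis st π , dd))
    ctraces′ (d , wvis (sumR st) π , dd) = CTraces-∷-⊕ʳ (ctraces R' (d , wvis st π , dd))

  ≍-sym : ∀ {p q} → p ≍ q → q ≍ p
  ≍-sym (R , Rᵒ) = Rᵒ , R

  derivable⇒≍ : ∀ {E t u} → Sound E → E ⊢ t ≈ u → ∀ σ → ClosedSubst σ → (t [ σ ]) ≍ (u [ σ ])
  derivable⇒≍ sound (ax {t} {u} e) σ c =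
    ⊑WIF⇒≼ (proj₁ (sound t u e) σ c) , ⊑WIF⇒≼ (proj₂ (sound t u e) σ c)
  derivable⇒≍ sound refl≈ σ c = ≼-refl , ≼-refl
  derivable⇒≍ sound (sym≈ d) σ c = ≍-sym (derivable⇒≍ sound d σ c)
  derivable⇒≍ sound (trans≈ d₁ d₂) σ c with derivable⇒≍ sound d₁ σ c | derivable⇒≍ sound d₂ σ c
  ... | R₁ , R₁ᵒ | R₂ , R₂ᵒ = ≼-trans R₁ R₂ , ≼-trans R₂ᵒ R₁ᵒ
  derivable⇒≍ sound (subst≈ {t} {u} ρ d) σ c =
    subst₂ _≍_ (sym ([]-∘ t)) (sym ([]-∘ u)) (derivable⇒≍ sound d (σ ∘ˢ ρ) (closed-∘ˢ c ρ))
  derivable⇒≍ sound (pref≈ τ d) σ c with derivable⇒≍ sound d σ c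
  ... | R , Rᵒ = ≼-τ· R , ≼-τ· Rᵒ
  derivable⇒≍ sound (pref≈ (vis b) d) σ c with derivable⇒≍ sound d σ c
  ... | R , Rᵒ = ≼-vis· R , ≼-vis· Rᵒ
  derivable⇒≍ sound (sum≈ d₁ d₂) σ c with derivable⇒≍ sound d₁ σ c | derivable⇒≍ sound d₂ σ c
  ... | E₁ | E₂ = ≼-⊕ E₁ E₂ , ≼-⊕ (≍-sym E₁) (≍-sym E₂)

  𝟎ˢ : Subst
  𝟎ˢ _ = 𝟎

  deepest-trace : ∀ t → ∃ λ s → (length s ≡ depth t) × Traces (t [ 𝟎ˢ ]) s
  deepest-trace 𝟎 = [] , refl , _ , wrefl
  deepest-trace (var x) = [] , refl , _ , wrefl
  deepest-trace (τ · t) with deepest-trace t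
  ... | s , eq , r , π = s , eq , r , wtau pref π
  deepest-trace (vis b · t) with deepest-trace t
  ... | s , eq , r , π = b ∷ s , cong suc eq , r , wvis pref π
  deepest-trace (t ⊕ u) with ≤-total (depth t) (depth u)
  ... | inj₁ t≤u with deepest-trace u
  ...   | s , eq , tr = s , trans eq (sym (m≤n⇒m⊔n≡n t≤u)) , Traces-⊕ʳ tr
  deepest-trace (t ⊕ u) | inj₂ u≤t with deepest-trace t
  ...   | s , eq , tr = s , trans eq (sym (m≥n⇒m⊔n≡m u≤t)) , Traces-⊕ˡ tr

  trace-length≤depth : ∀ u {s} → Traces (u [ 𝟎ˢ ]) s → length s ≤ depth u
  trace-length≤depth u (r , π) with split 𝟎ˢ u π
  ... | inside π' _ = path-length≤depth π'
  ... | through _ _ () _ _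

  ⊑WIFo⇒depth≤ : ∀ {t u} → t ⊑WIFo u → depth t ≤ depth u
  ⊑WIFo⇒depth≤ {t} {u} W with deepest-trace t
  ... | s , eq , tr =
    subst (_≤ depth u) eq (trace-length≤depth u (proj₁ (proj₁ (proj₂ (W 𝟎ˢ (λ _ → c𝟎))) s) tr))

module Transfer (A : Set) (E : BCCS.Axioms A) (sound : BCCS.Sound A E) (a : A) (m : ℕ)
              (bounded : ∀ t u → E t u → BCCS.depth A u < m) where
  open BCCS A
  open WeakPaths A
  open Substitution A
  open Preorder A
  open ≡-Reasoning

  short long : List A
  short = pow a m
  long = pow a (2 * m)

  length-pow-++ : ∀ {k} s₁ {s₂} → pow a k ≡ s₁ ++ s₂ → length s₁ + length s₂ ≡ k
  length-pow-++ {k} s₁ {s₂} eq = begin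
    length s₁ + length s₂  ≡⟨ sym (length-++ s₁) ⟩
    length (s₁ ++ s₂)      ≡⟨ cong length (sym eq) ⟩
    length (pow a k)       ≡⟨ length-replicate k ⟩
    k                      ∎

  length+k≡k⇒[] : ∀ (s : List A) {k} → length s + k ≡ k → s ≡ []
  length+k≡k⇒[] [] _ = refl
  length+k≡k⇒[] (b ∷ s) {k} eq = ⊥-elim (<-irrefl refl (subst (k <_) eq (s≤s (m≤n+m k (length s)))))

  short-prefix-of-long : ∀ {x L} → x < m → x + L ≡ 2 * m → m < L
  short-prefix-of-long {x} {L} x<m eq with L ≤? m
  ... | no L≰m = ≰⇒> L≰m
  ... | yes L≤m = ⊥-elim (<-irrefl (trans eq (cong (m +_) (+-identityʳ m))) (+-mono-<-≤ x<m L≤m))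

  chain : ℕ → Term
  chain zero = 𝟎
  chain (suc k) = vis a · chain k

  chain-closed : ∀ k → Closed (chain k)
  chain-closed zero = c𝟎
  chain-closed (suc k) = c· (chain-closed k)

  chain-path : ∀ k → chain k =[ pow a k ]⇒ 𝟎
  chain-path zero = wrefl
  chain-path (suc k) = wvis pref (chain-path k)

  chain-τ-free : ∀ k {r} → ¬ (chain k —[ τ ]→ r)
  chain-τ-free zero ()
  chain-τ-free (suc k) ()

  chain-ctrace-length : ∀ k {s d} → chain k =[ s ]⇒ d → Dead d → length s ≡ k
  chain-ctrace-length zero wrefl _ = refl
  chain-ctrace-length (suc k) wrefl dd = ⊥-elim (dd a (_ , _ , wrefl , pref))
  chain-ctrace-length (suc k) (wvis pref π) dd = cong suc (chain-ctrace-length k π dd)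

  OnlyLong : Term → Set
  OnlyLong p = ∀ s → (CTraces p s → s ≡ long) × (s ≡ long → CTraces p s)

  OnlyLong-intro : ∀ {p} → (∀ s → CTraces p s → s ≡ long) → OnlyLong p
  OnlyLong-intro {p} f s with ctrace-exists p
  ... | s₀ , c₀ = f s , λ eq → subst (CTraces p) (trans (f s₀ c₀) (sym eq)) c₀

  OnlyLong-⊇ : ∀ {p r} → (∀ {s} → CTraces r s → CTraces p s) → OnlyLong p → OnlyLong r
  OnlyLong-⊇ incl p-long = OnlyLong-intro (λ s c → proj₁ (p-long s) (incl c))

  OnlyLong-trace-length : ∀ {p w} → OnlyLong p → Traces p w → length w ≤ 2 * m
  OnlyLong-trace-length {w = w} p-long (r , π) with ctrace-exists r
  ... | c , d , πc , dd =
    subst (length w ≤_) (length-pow-++ w (sym (proj₁ (p-long _) (d , π ++ᵖ πc , dd))))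
      (m≤m+n (length w) (length c))

  HasLongτ : Term → Set
  HasLongτ p = ∃ λ p' → (p ⇒τ p') × OnlyLong p'

  -- If the τ-path is empty, q itself is OnlyLong and so is its τ-successor.
  ⇒-OnlyLong⇒HasLongτ : ∀ {q q'} → q ⇒ q' → OnlyLong q' → τ-Enabled q → HasLongτ q
  ⇒-OnlyLong⇒HasLongτ wrefl q-long (r , st) =
    r , (_ , wrefl , st) , OnlyLong-⊇ (CTraces-⇒ (wtau st wrefl)) q-long
  ⇒-OnlyLong⇒HasLongτ (wtau st π) q'-long _ = _ , τ-step-⇒τ st π , q'-long

  ShortOrLong : Term → Set
  ShortOrLong q = ∀ s → CTraces q s → (s ≡ short) ⊎ (s ≡ long)

  -- The guard τ-Enabled q is what lets the hypothesis pass from q ⊕ q' to q.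
  τ-ShortOrLong : Term → Set
  τ-ShortOrLong q = τ-Enabled q → ShortOrLong q

  Transfers : Term → Term → Set
  Transfers p q = τ-ShortOrLong q → HasLongτ p → HasLongτ q

  module AxiomInstance (t u : Term) (σ : Subst) (cσ : ClosedSubst σ) (W : t ⊑WIFo u)
                       (t<m : depth t < m) (u<m : depth u < m) where

    -- Instantiating x by a^(1+|u|)·𝟎 and all other variables by 𝟎 gives t[ρ] a completed
    -- trace longer than any path inside u, so u must reach x by τ-steps alone.
    through-variable : ∀ {t₁ x p'} → t ⇒ t₁ → TopVar t₁ x → σ x ⇒τ p' → (u [ σ ]) ⇒τ p'
    through-variable {t₁} {x} {p'} π₁ tv σx⇒τp' =
      reach-x (ctraces (⊑WIF⇒≼ (W ρ (patch-closed (λ _ → chain-closed (suc D)) c𝟎))) ct-t)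
      where
      D : ℕ
      D = depth u
      open Patch (x ∷ []) (λ _ → chain (suc D)) 𝟎 renaming (patch to ρ)

      ρ-step : ∀ {y α r} → ρ y —[ α ]→ r → (y ≡ x) × (α ≡ vis a) × (r ≡ chain D)
      ρ-step {y} st with patch-step {y} st
      ... | inj₁ (here y≡x , pref) = y≡x , refl , refl
      ... | inj₂ (_ , ())

      ct-t : CTraces (t [ ρ ]) (pow a (suc D))
      ct-t = 𝟎 , path-[]⁺ ρ π₁ ++ᵖ step-⇒ (TopVar-step ρ tv ρx-step) (chain-path D) , 𝟎-dead
        where
        ρx-step : ρ x —[ vis a ]→ chain D
        ρx-step = subst (λ z → z —[ vis a ]→ chain D) (sym (patch-∈ (here refl))) pref

      reach-x : CTraces (u [ ρ ]) (pow a (suc D)) → (u [ σ ]) ⇒τ p'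
      reach-x (d , π , dd) with split ρ u π
      ... | inside π' _ =
        ⊥-elim (<-irrefl refl (subst (_≤ D) (length-replicate (suc D)) (path-length≤depth π')))
      ... | through {s₁} {x = y} {s₂ = s₂} π' tv' st πr eq with ρ-step {y} st
      ...   | refl , refl , refl =
        ⇒-⇒τ (path-[]⁺ σ (subst (λ s → u =[ s ]⇒ _) s₁≡[] π')) (TopVar-⇒τ σ tv' σx⇒τp')
        where
        s₁≡[] : s₁ ≡ []
        s₁≡[] = length+k≡k⇒[] s₁ (begin
          length s₁ + suc D              ≡⟨ cong (λ n → length s₁ + suc n) (sym (chain-ctrace-length D πr dd)) ⟩
          length s₁ + length (a ∷ s₂)    ≡⟨ length-pow-++ s₁ eq ⟩
          suc D                          ∎)

    module InsideStep {t₂ t' : Term} (π₁ : t ⇒ t₂) (st : t₂ —[ τ ]→ t') (t'σ-long : OnlyLong (t' [ σ ]))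
                      (uσ-τ : τ-Enabled (u [ σ ])) (uσ-ct : ShortOrLong (u [ σ ])) where
      V : List ℕ
      V = vars t'
      open Patch V σ (chain (suc (2 * m))) renaming (patch to ρ)

      t⇒t' : t ⇒ t'
      t⇒t' = π₁ ++ᵖ wtau st wrefl

      -- A run from σ y with y ∈ V completes the trace a^2m of t'[σ] after a prefix inside t', of length < m.
      variable-run-long : ∀ {y α r₀ s₂ d} → y ∈ V → σ y —[ α ]→ r₀ → r₀ =[ s₂ ]⇒ d → Dead d →
                          m < length (α ∷ᵛ s₂)
      variable-run-long y∈V σy-step πr dd with ∈vars⇒reachable t' y∈V
      ... | s₃ , _ , π₃ , tv =
        short-prefix-of-long (≤-<-trans (path-length≤depth π₃) (≤-<-trans (path-depth-mono t⇒t') t<m))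
          (length-pow-++ s₃ (sym (proj₁ (t'σ-long _)
            (_ , path-[]⁺ σ π₃ ++ᵖ step-⇒ (TopVar-step σ tv σy-step) πr , dd))))

      only-long : ∀ {p} → (∀ {s} → CTraces p s → CTraces (u [ σ ]) s) → ¬ CTraces p short → OnlyLong p
      only-long {p} incl ¬short = OnlyLong-intro long-only
        where
        long-only : ∀ s → CTraces p s → s ≡ long
        long-only s c with uσ-ct s (incl c)
        ... | inj₁ refl = ⊥-elim (¬short c)
        ... | inj₂ s≡long = s≡long

      inside-not-short : ∀ {u'} → u ⇒ u' → (∀ y → y ∈ vars u' → y ∈ V) → ¬ CTraces (u' [ σ ]) short
      inside-not-short {u'} π' vars⊆V (d , π , dd) with split σ u' π
      ... | inside π'' _ =
        <-irrefl refl (≤-<-trans (subst (_≤ depth u') (length-replicate m) (path-length≤depth π''))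
                                 (≤-<-trans (path-depth-mono π') u<m))
      ... | through {s₁} {α = α} {s₂ = s₂} π'' tv σy-step πr eq =
        <-irrefl refl (<-≤-trans (variable-run-long (vars⊆V _ (path-vars π'' (TopVar⇒∈vars tv))) σy-step πr dd)
                                 (subst (length (α ∷ᵛ s₂) ≤_) (length-pow-++ s₁ eq) (m≤n+m _ (length s₁))))

      -- (ε, complement of T(t'[σ])) is a weak impossible future of t[ρ], since t'[ρ] = t'[σ].
      future : WIF (u [ ρ ]) [] (λ w → ¬ Traces (t' [ σ ]) w)
      future = proj₁ (W ρ (patch-closed cσ (chain-closed _))) [] _
        (t' [ ρ ] , path-[]⁺ ρ t⇒t' , λ w tr ¬tr → ¬tr (subst (λ z → Traces z w) t'ρ≡t'σ tr))
        where
        t'ρ≡t'σ : t' [ ρ ] ≡ t' [ σ ]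
        t'ρ≡t'σ = []-cong-vars t' (λ y y∈V → patch-∈ y∈V)

      vars-⊆V : ∀ {u'} → (∀ w → Traces (u' [ ρ ]) w → ¬ ¬ Traces (t' [ σ ]) w) → ∀ y → y ∈ vars u' → y ∈ V
      vars-⊆V {u'} traces⊆ y y∈u' with y ∈? V
      ... | yes y∈V = y∈V
      ... | no y∉V with ∈vars⇒reachable u' y∈u'
      ...   | s , _ , π , tv =
        ⊥-elim (traces⊆ _ (𝟎 , path-[]⁺ ρ π ++ᵖ wvis (TopVar-step ρ tv ρy-step) (chain-path (2 * m))) too-long)
        where
        ρy-step : ρ y —[ vis a ]→ chain (2 * m)
        ρy-step = subst (λ z → z —[ vis a ]→ chain (2 * m)) (sym (patch-∉ y∉V)) pref
        too-long : ¬ Traces (t' [ σ ]) (s ++ a ∷ long)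
        too-long tr = <-irrefl refl (<-≤-trans
          (<-≤-trans (s≤s (≤-reflexive (sym (length-replicate (2 * m))))) (length-++-≤ʳ (a ∷ long) {s}))
          (OnlyLong-trace-length t'σ-long tr))

      transfer-inside : HasLongτ (u [ σ ])
      transfer-inside with future
      ... | q , π , traces⊆ with split ρ u π
      ...   | inside {u'} π' refl =
        ⇒-OnlyLong⇒HasLongτ (path-[]⁺ σ π')
          (only-long {u' [ σ ]} (CTraces-⇒ (path-[]⁺ σ π')) (inside-not-short π' (vars-⊆V {u'} traces⊆))) uσ-τ
      ...   | through {[]} {α = vis b} _ _ _ _ ()
      ...   | through {_ ∷ _} _ _ _ _ ()
      ...   | through {[]} {x = y} {α = τ} {r₀ = r₀} {s₂ = []} π' tv ρy-step πr refl with patch-step {y} ρy-step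
      ...     | inj₂ (_ , chain-step) = ⊥-elim (chain-τ-free _ chain-step)
      ...     | inj₁ (y∈V , σy-step) = q , uσ⇒τq , only-long (CTraces-⇒ (⇒τ⇒⇒ uσ⇒τq)) q-not-short
        where
        uσ⇒τq : (u [ σ ]) ⇒τ q
        uσ⇒τq = ⇒-⇒τ (path-[]⁺ σ π') (TopVar-⇒τ σ tv (τ-step-⇒τ σy-step πr))
        q-not-short : ¬ CTraces q short
        q-not-short (d , π , dd) =
          <-irrefl (sym (length-replicate m)) (variable-run-long y∈V σy-step (πr ++ᵖ π) dd)

    axiom-transfer : Transfers (t [ σ ]) (u [ σ ])
    axiom-transfer guard (p' , tσ⇒τp'@(v , π , st) , p'-long) = go (split σ t π)
      where
      uσ-τ : τ-Enabled (u [ σ ])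
      uσ-τ = proj₂ (proj₂ (W σ cσ)) _ (proj₂ (⇒τ⇒τ-Enabled tσ⇒τp'))
      go : Split σ t [] v → HasLongτ (u [ σ ])
      go (inside {t₂} π₁ refl) with step-[]⁻ σ t₂ st
      ... | inj₁ (t' , st₁ , refl) = InsideStep.transfer-inside π₁ st₁ p'-long uσ-τ (guard uσ-τ)
      ... | inj₂ (x , tv , σx-step) = p' , through-variable π₁ tv (σ x , wrefl , σx-step) , p'-long
      go (through {[]} {α = τ} {s₂ = []} π₁ tv σx-step πr refl) =
        p' , through-variable π₁ tv (v , wtau σx-step πr , st) , p'-long
      go (through {[]} {α = vis _} _ _ _ _ ())
      go (through {_ ∷ _} _ _ _ _ ())

  guard-≼ : ∀ {r u} → r ≼ u → τ-ShortOrLong u → τ-ShortOrLong r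
  guard-≼ R guard r-τ s c = guard (τ-enabled R r-τ) s (ctraces R c)

  transfer-trans : ∀ {t u v} → u ≼ v → Transfers t u → Transfers u v → Transfers t v
  transfer-trans u≼v T₁ T₂ guard = T₂ guard ∘ T₁ (guard-≼ u≼v guard)

  -- When p itself is the τ-derivative, q is one too, and q ≼ p gives it only the long trace.
  transfer-τ· : ∀ {p q} → q ≼ p → Transfers p q → Transfers (τ · p) (τ · q)
  transfer-τ· {q = q} q≼p _ _ (p' , (_ , wrefl , pref) , p'-long) =
    q , (τ · q , wrefl , pref) , OnlyLong-⊇ (ctraces q≼p) p'-long
  transfer-τ· _ T guard (p' , (v , wtau pref π , st) , p'-long)
    with T (λ _ s c → guard (_ , pref) s (CTraces-τ·⁺ c)) (p' , (v , π , st) , p'-long)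
  ... | q' , q⇒τq' , q'-long = q' , ⇒-⇒τ (wtau pref wrefl) q⇒τq' , q'-long

  transfer-vis· : ∀ {p q b} → Transfers (vis b · p) (vis b · q)
  transfer-vis· _ (_ , (_ , wrefl , ()) , _)
  transfer-vis· _ (_ , (_ , wtau () _ , _) , _)

  transfer-⊕ : ∀ {p q p' q'} → Transfers p q → Transfers p' q' → Transfers (p ⊕ p') (q ⊕ q')
  transfer-⊕ {p} {q} {p'} {q'} T T' guard (r , (v , π , st) , r-long) = go π st
    where
    in-left : HasLongτ q → HasLongτ (q ⊕ q')
    in-left (x , q⇒τx , x-long) = x , ⇒τ-⊕ˡ q⇒τx , x-long
    in-right : HasLongτ q' → HasLongτ (q ⊕ q')
    in-right (x , q'⇒τx , x-long) = x , ⇒τ-⊕ʳ q'⇒τx , x-long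
    guard-q : τ-ShortOrLong q
    guard-q q-τ s c = guard (_ , sumL (proj₂ q-τ)) s (CTraces-⊕ˡ q-τ c)
    guard-q' : τ-ShortOrLong q'
    guard-q' q'-τ s c = guard (_ , sumR (proj₂ q'-τ)) s (CTraces-⊕ʳ q'-τ c)
    go : ∀ {v} → (p ⊕ p') ⇒ v → v —[ τ ]→ r → HasLongτ (q ⊕ q')
    go wrefl (sumL st₀) = in-left (T guard-q (r , (_ , wrefl , st₀) , r-long))
    go wrefl (sumR st₀) = in-right (T' guard-q' (r , (_ , wrefl , st₀) , r-long))
    go (wtau (sumL st₀) π) st = in-left (T guard-q (r , τ-step-⇒τ st₀ (π ++ᵖ wtau st wrefl) , r-long))
    go (wtau (sumR st₀) π) st = in-right (T' guard-q' (r , τ-step-⇒τ st₀ (π ++ᵖ wtau st wrefl) , r-long))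

  transfer : ∀ {t u} → E ⊢ t ≈ u → ∀ σ → ClosedSubst σ →
             Transfers (t [ σ ]) (u [ σ ]) × Transfers (u [ σ ]) (t [ σ ])
  transfer (ax {t} {u} e) σ c =
    AxiomInstance.axiom-transfer t u σ c t⊑u t<m u<m , AxiomInstance.axiom-transfer u t σ c u⊑t u<m t<m
    where
    t⊑u : t ⊑WIFo u
    t⊑u = proj₁ (sound t u e)
    u⊑t : u ⊑WIFo t
    u⊑t = proj₂ (sound t u e)
    u<m : depth u < m
    u<m = bounded t u e
    t<m : depth t < m
    t<m = ≤-<-trans (⊑WIFo⇒depth≤ {t} {u} t⊑u) u<m
  transfer refl≈ σ c = (λ _ h → h) , (λ _ h → h)
  transfer (sym≈ d) σ c = swap (transfer d σ c)
  transfer (trans≈ d₁ d₂) σ c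
    with transfer d₁ σ c | transfer d₂ σ c | derivable⇒≍ sound d₁ σ c | derivable⇒≍ sound d₂ σ c
  ... | T₁ , T₁ᵒ | T₂ , T₂ᵒ | R₁ , R₁ᵒ | R₂ , R₂ᵒ = transfer-trans R₂ T₁ T₂ , transfer-trans R₁ᵒ T₂ᵒ T₁ᵒ
  transfer (subst≈ {t} {u} ρ d) σ c =
    subst₂ (λ x y → Transfers x y × Transfers y x) (sym ([]-∘ t)) (sym ([]-∘ u))
      (transfer d (σ ∘ˢ ρ) (closed-∘ˢ c ρ))
  transfer (pref≈ τ d) σ c with transfer d σ c | derivable⇒≍ sound d σ c
  ... | T , Tᵒ | R , Rᵒ = transfer-τ· Rᵒ T , transfer-τ· R Tᵒ
  transfer (pref≈ (vis b) d) σ c = transfer-vis· , transfer-vis·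
  transfer (sum≈ d₁ d₂) σ c with transfer d₁ σ c | transfer d₂ σ c
  ... | T₁ , T₁ᵒ | T₂ , T₂ᵒ = transfer-⊕ T₁ T₂ , transfer-⊕ T₁ᵒ T₂ᵒ

lemma8 : (A : Set) → let open BCCS A in
    (E : Axioms) → Sound E →
    (p q : Term) → Closed p → Closed q → (a : A) → (m : ℕ) →
    E ⊢ p ≈ q →
    (∀ t u → E t u → depth u < m) →
    (∀ s → CTraces q s → (s ≡ pow a m) ⊎ (s ≡ pow a (2 * m))) →
    (Σ Term λ p' → Closed p' × (p ⇒τ p')
    × (∀ s → (CTraces p' s → s ≡ pow a (2 * m)) × (s ≡ pow a (2 * m) → CTraces p' s))) →
    Σ Term λ q' → Closed q' × (q ⇒τ q')
    × (∀ s → (CTraces q' s → s ≡ pow a (2 * m)) × (s ≡ pow a (2 * m) → CTraces q' s))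
lemma8 A E sound p q cp cq a m p≈q bounded q-ct (p' , _ , p⇒τp' , p'-long) =
  closed-witness (transfer-p-q (λ _ → q-ct) (p' , p⇒τp' , p'-long))
  where
  open BCCS A
  open WeakPaths A
  open Substitution A
  open Preorder A
  open Transfer A E sound a m bounded

  transfer-p-q : Transfers p q
  transfer-p-q = subst₂ Transfers (closed-[]-id cp) (closed-[]-id cq) (proj₁ (transfer p≈q 𝟎ˢ (λ _ → c𝟎)))

  closed-witness : HasLongτ q → Σ Term λ q' → Closed q' × (q ⇒τ q') × OnlyLong q'
  closed-witness (q' , q⇒τq' , q'-long) = q' , closed-path cq (⇒τ⇒⇒ q⇒τq') , q⇒τq' , q'-long
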